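{- Let $G=(V,E)$ be a graph with $n$ vertices, let $E^?\subseteq E$ be a set of $b$ edges, and let $\pi$ be a uniformly random permutation of $V$. Run $F(G,\emptyset,E^?,1)$ (InfluenceMIS, described in the context), and let $V_i^?$ denote the set of undecided vertices at the beginning of the call with index $i$ (taken to be $\emptyset$ if the recursion has already terminated). Then for every $i<n/4$, $\mathbb{E}\big[|V_i^?|\big]\le \frac{4bi}{n}$.
   Context: Procedure $F(G,V^?,E^?,i)$ (InfluenceMIS), where $G=(V,E)$ is the current graph, $V^?\subseteq V$ undecided vertices, $E^?\subseteq E$ undecided edges: (1) if $V^?=\emptyset$ and $E^?=\emptyset$, return $\emptyset$. (2) Let $u=\pi(i)$. If $u\notin V$, return $F(G,V^?,E^?,i+1)$. (3) If $u\in V^?$: add every current neighbor of $u$ to $V^?$; delete $u$ from $G,V^?,E^?$; return $\{u\}\cup F(G,V^?,E^?,i+1)$. (4) Otherwise, for each current neighbor $v$ of $u$: if $(u,v)\in E^?$, add $v$ to $V^?$; else delete $v$ from $G,V^?,E^?$. Then delete $u$ from $G,V^?,E^?$ and return $F(G,V^?,E^?,i+1)$. Deleting a vertex from $G$ removes it and its incident edges; deleting it from $E^?$ removes the undecided edges incident to it. -}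

module Defs where

open import Data.Bool using (Bool; true; false; _∧_; _∨_; not; if_then_else_)
open import Data.Nat using (ℕ; zero; suc; _+_; _*_; _∸_; _<ᵇ_)
open import Data.Fin using (Fin; toℕ; _≟_)
open import Data.Nat.ListAction using (sum)
open import Data.Bool.ListAction using (all)
open import Data.List using (List; []; _∷_; map; allFin; foldl; take; filterᵇ; length; concatMap)
open import Data.Vec using (Vec; lookup; toList) renaming ([] to []ᵥ; _∷_ to _∷ᵥ_)
open import Relation.Nullary.Decidable using (⌊_⌋)

-- A (simple) graph on vertex set Fin n : symmetric irreflexive Bool adjacency.
Rel₂ : ℕ → Set
Rel₂ n = Fin n → Fin n → Bool

_==_ : ∀ {n} → Fin n → Fin n → Bool
u == v = ⌊ u ≟ v ⌋

edgeCount : ∀ {n} → Rel₂ n → ℕ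
edgeCount {n} r =
  sum (map (λ u → length (filterᵇ (λ v → (toℕ u <ᵇ toℕ v) ∧ r u v) (allFin n))) (allFin n))

card : ∀ {n} → (Fin n → Bool) → ℕ
card {n} s = length (filterᵇ s (allFin n))

-- State of InfluenceMIS: current vertex set V (alive), undecided vertices V?,
-- undecided edges E?.  The current graph G is the input graph restricted to alive.
record State (n : ℕ) : Set where
  constructor st
  field
    alive : Fin n → Bool
    undV  : Fin n → Bool
    undE  : Rel₂ n
open State public

finished : ∀ {n} → State n → Bool
finished {n} s =
  all (λ u → not (undV s u) ∧ all (λ v → not (undE s u v)) (allFin n)) (allFin n)

-- One call of F with u = π(i), for the input graph with adjacency adj.
-- Current neighbours of u: alive v with adj u v.
step : ∀ {n} → Rel₂ n → State n → Fin n → State n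
step adj s u =
  if finished s then s                       -- (1) recursion has terminated
  else if not (alive s u) then s
  else if undV s u then case3
  else case4
  where
    nb : _ → Bool
    nb v = alive s v ∧ adj u v
    restrictE : (_ → Bool) → Rel₂ _
    restrictE al w x = undE s w x ∧ al w ∧ al x
    case3 : State _
    case3 = st al' vu' (restrictE al')
      where
        al' : _ → Bool
        al' w = alive s w ∧ not (w == u)
        vu' : _ → Bool
        vu' w = (undV s w ∨ nb w) ∧ al' w
    case4 : State _
    case4 = st al' vu' (restrictE al')
      where
        al' : _ → Bool
        al' w = alive s w ∧ not (w == u) ∧ not (nb w ∧ not (undE s u w))
        vu' : _ → Bool
        vu' w = (undV s w ∨ (nb w ∧ undE s u w)) ∧ al' w

initState : ∀ {n} → Rel₂ n → State n
initState eu = st (λ _ → true) (λ _ → false) eu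

-- V?_i : undecided vertices at the beginning of the call with index i (i ≥ 1),
-- i.e. after the calls with indices 1 … i-1 (π(j) = lookup π (j-1)).
undecidedAt : ∀ {n} → Rel₂ n → Rel₂ n → Vec (Fin n) n → ℕ → Fin n → Bool
undecidedAt adj eu π i = undV (foldl (step adj) (initState eu) (take (i ∸ 1) (toList π)))

allVecs : ∀ {n} (k : ℕ) → List (Vec (Fin n) k)
allVecs {n} zero = []ᵥ ∷ []
allVecs {n} (suc k) = concatMap (λ x → map (x ∷ᵥ_) (allVecs k)) (allFin n)

-- A vector π : Fin n → Fin n (π(j) = lookup π (j-1)) is a permutation iff injective.
isPerm : ∀ {n} → Vec (Fin n) n → Bool
isPerm {n} π = all (λ j → all (λ k → (j == k) ∨ not (lookup π j == lookup π k)) (allFin n)) (allFin n)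

-- All permutations of Fin n (each exactly once); uniform distribution = counting.
perms : (n : ℕ) → List (Vec (Fin n) n)
perms n = filterᵇ isPerm (allVecs n)

{-# OPTIONS --safe #-}
module Submission where

-- Let T p sum, over all n! orderings π, the number of undecided vertices after the first p
-- calls.  Fix a state and sum |V?| after one further call over all n choices of its vertex u:
-- calling an undecided u makes its decided neighbours undecided, calling a decided u deletes its
-- undecided neighbours except those across an undecided edge.  So every adjacent pair of a
-- decided and an undecided vertex is gained once and lost once unless its edge is undecided, and
-- the sum is at most n |V?| + 2b.  Now sum this over π, letting call p + 1 take the vertex π(k)
-- for each position k: for the p positions already processed nothing changes, and for every
-- other k swapping positions k and p + 1 of π turns it into the genuine call p + 1.  Hence
-- p·T p + (n − p)·T (p + 1) ≤ n·T p + 2b·n!, which for 2p ≤ n gives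
-- n·(T (p + 1) − T p) ≤ 4b·n!; summing from T 0 = 0 gives the bound.

open import Defs
open import Data.Bool using (Bool; true; false; _∧_; _∨_; not; T; T?)
open import Data.Bool.ListAction using (all)
open import Data.Bool.Properties using (T-≡; T-not-≡; T-∧; ∧-zeroʳ; ∧-conicalˡ)
open import Data.Empty using (⊥-elim)
open import Data.Fin using (Fin; toℕ; fromℕ<; _≟_; punchOut) renaming (zero to fzero; suc to fsuc)
open import Data.Fin.Properties using (any?; punchOut-injective; injective⇒≤; toℕ-injective; toℕ<n; toℕ-fromℕ<)
import Data.Fin.Permutation.Components as PC
open import Data.List using (List; []; _∷_; [_]; _++_; map; length; filterᵇ; foldl; take; allFin; cartesianProductWith; concatMap)
open import Data.List.Membership.Propositional using (_∈_)
open import Data.List.Membership.Propositional.Properties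
  using (∈-allFin; ∈-map⁺; ∈-map⁻; ∈-filter⁺; ∈-filter⁻; ∈-cartesianProductWith⁺)
open import Data.List.Membership.Propositional.Properties.WithK using (unique∧set⇒bag)
open import Data.List.Properties using (map-cong; map-∘; map-tabulate; length-tabulate; foldl-++)
open import Data.List.Relation.Binary.BagAndSetEquality using (∼bag⇒↭)
open import Data.List.Relation.Binary.Permutation.Propositional using (_↭_)
import Data.List.Relation.Binary.Permutation.Propositional.Properties as ↭
open import Data.List.Relation.Unary.Any using (here; there)
import Data.List.Relation.Unary.All as All
open import Data.List.Relation.Unary.All.Properties using (all⁺; all⁻)
open import Data.List.Relation.Unary.Unique.Propositional using (Unique)
import Data.List.Relation.Unary.AllPairs as AllPairs
import Data.List.Relation.Unary.Unique.Propositional.Properties as Unique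
open import Data.Nat using (ℕ; zero; suc; _+_; _*_; _∸_; _≤_; _<_; _≤?_; _<ᵇ_; z≤n; s≤s)
open import Data.Nat.ListAction using (sum)
open import Data.Nat.ListAction.Properties using (sum-↭)
open import Data.Nat.Properties hiding (_≟_)
open import Algebra.Properties.CommutativeSemigroup +-commutativeSemigroup using (interchange; xy∙z≈xz∙y)
open import Data.Nat.Tactic.RingSolver using (solve-∀)
open import Data.Product using (∃-syntax; _×_; _,_; proj₁)
open import Data.Sum using (_⊎_; inj₁; inj₂)
open import Data.Vec using (Vec; lookup; toList) renaming ([] to []ᵥ; _∷_ to _∷ᵥ_; tabulate to tabulateᵥ)
open import Data.Vec.Properties using (lookup∘tabulate; tabulate∘lookup)
  renaming (tabulate-cong to tabulateᵥ-cong; ∷-injective to ∷ᵥ-injective)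
open import Function using (_∘_; mk⇔; Equivalence)
open import Relation.Binary.PropositionalEquality using (_≡_; _≢_; refl; sym; trans; cong; cong₂; subst; module ≡-Reasoning)
open import Relation.Nullary using (Dec; yes; no; contradiction)
open import Relation.Nullary.Decidable using (dec-true; dec-false; toWitness)

private variable
  A B : Set
  n : ℕ

⟦_⟧ : Bool → ℕ
⟦ true  ⟧ = 1
⟦ false ⟧ = 0

∑ : List A → (A → ℕ) → ℕ
∑ xs f = sum (map f xs)

syntax ∑ xs (λ x → e) = ∑[ x ∈ xs ] e

∑-cong : (xs : List A) {f g : A → ℕ} → (∀ x → f x ≡ g x) → ∑ xs f ≡ ∑ xs g
∑-cong xs f≗g = cong sum (map-cong f≗g xs)

∑-mono : (xs : List A) {f g : A → ℕ} → (∀ {x} → x ∈ xs → f x ≤ g x) → ∑ xs f ≤ ∑ xs g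
∑-mono []       f≤g = z≤n
∑-mono (x ∷ xs) f≤g = +-mono-≤ (f≤g (here refl)) (∑-mono xs (f≤g ∘ there))

∑-distrib-+ : (xs : List A) (f g : A → ℕ) → ∑[ x ∈ xs ] (f x + g x) ≡ ∑ xs f + ∑ xs g
∑-distrib-+ []       f g = refl
∑-distrib-+ (x ∷ xs) f g = trans (cong (f x + g x +_) (∑-distrib-+ xs f g))
                                 (interchange (f x) (g x) (∑ xs f) (∑ xs g))

∑-distribˡ-* : (xs : List A) (c : ℕ) (f : A → ℕ) → ∑[ x ∈ xs ] (c * f x) ≡ c * ∑ xs f
∑-distribˡ-* []       c f = sym (*-zeroʳ c)
∑-distribˡ-* (x ∷ xs) c f = trans (cong (c * f x +_) (∑-distribˡ-* xs c f)) (sym (*-distribˡ-+ c (f x) (∑ xs f)))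

∑-const : (xs : List A) (c : ℕ) → ∑[ _ ∈ xs ] c ≡ length xs * c
∑-const []       c = refl
∑-const (x ∷ xs) c = cong (c +_) (∑-const xs c)

∑-zero : (xs : List A) → ∑[ _ ∈ xs ] 0 ≡ 0
∑-zero []       = refl
∑-zero (x ∷ xs) = ∑-zero xs

∑-comm : (xs : List A) (ys : List B) (f : A → B → ℕ) →
         ∑[ x ∈ xs ] ∑[ y ∈ ys ] f x y ≡ ∑[ y ∈ ys ] ∑[ x ∈ xs ] f x y
∑-comm []       ys f = sym (∑-zero ys)
∑-comm (x ∷ xs) ys f = trans (cong (∑ ys (f x) +_) (∑-comm xs ys f)) (sym (∑-distrib-+ ys (f x) _))

∑-map : (xs : List A) (g : A → B) (f : B → ℕ) → ∑ (map g xs) f ≡ ∑[ x ∈ xs ] f (g x)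
∑-map xs g f = cong sum (sym (map-∘ xs))

∑-↭ : {xs ys : List A} (f : A → ℕ) → xs ↭ ys → ∑ xs f ≡ ∑ ys f
∑-↭ f xs↭ys = sum-↭ (↭.map⁺ f xs↭ys)

length-filterᵇ : (p : A → Bool) (xs : List A) → length (filterᵇ p xs) ≡ ∑[ x ∈ xs ] ⟦ p x ⟧
length-filterᵇ p []       = refl
length-filterᵇ p (x ∷ xs) with p x
... | true  = cong suc (length-filterᵇ p xs)
... | false = length-filterᵇ p xs

∑-reindex : {xs : List A} {ys : List B} {f : A → B} → Unique xs → Unique ys →
            (∀ {x x′} → f x ≡ f x′ → x ≡ x′) →
            (∀ {x} → x ∈ xs → f x ∈ ys) →
            (∀ {y} → y ∈ ys → ∃[ x ] x ∈ xs × f x ≡ y) →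
            (g : B → ℕ) → ∑[ x ∈ xs ] g (f x) ≡ ∑ ys g
∑-reindex {xs = xs} {ys} {f} xs! ys! f-inj into onto g =
  trans (sym (∑-map xs f g)) (∑-↭ g (∼bag⇒↭ (unique∧set⇒bag (Unique.map⁺ f-inj xs!) ys! (mk⇔ to from))))
  where
  to : ∀ {y} → y ∈ map f xs → y ∈ ys
  to y∈ with x , x∈ , refl ← ∈-map⁻ f y∈ = into x∈
  from : ∀ {y} → y ∈ ys → y ∈ map f xs
  from y∈ with x , x∈ , refl ← onto y∈ = ∈-map⁺ f x∈

∑-allFin-suc : (h : Fin (suc n) → ℕ) → ∑ (allFin (suc n)) h ≡ h fzero + ∑[ k ∈ allFin n ] h (fsuc k)
∑-allFin-suc {n} h = cong (h fzero +_)
  (trans (cong sum (map-tabulate fsuc h)) (sym (cong sum (map-tabulate (λ k → k) (h ∘ fsuc)))))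

∑-allFin-split : ∀ n p (h : Fin n → ℕ) {c d : ℕ} → p ≤ n →
                 (∀ k → toℕ k < p → h k ≡ c) → (∀ k → p ≤ toℕ k → h k ≡ d) →
                 ∑ (allFin n) h ≡ p * c + (n ∸ p) * d
∑-allFin-split zero    zero    h p≤n below above = refl
∑-allFin-split (suc n) zero    h {c} p≤n below above = trans (∑-allFin-suc h)
  (cong₂ _+_ (above fzero z≤n) (∑-allFin-split n zero (h ∘ fsuc) {c} z≤n (λ _ ()) (λ k _ → above (fsuc k) z≤n)))
∑-allFin-split (suc n) (suc p) h {c} (s≤s p≤n) below above = trans (∑-allFin-suc h)
  (trans (cong₂ _+_ (below fzero (s≤s z≤n))
                    (∑-allFin-split n p (h ∘ fsuc) p≤n (λ k → below (fsuc k) ∘ s≤s) (λ k → above (fsuc k) ∘ s≤s)))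
         (sym (+-assoc c (p * c) _)))

foldl-preserves : {f : B → A → B} (P : B → Set) → (∀ b x → P b → P (f b x)) → ∀ xs b → P b → P (foldl f b xs)
foldl-preserves P pres []       b Pb = Pb
foldl-preserves P pres (x ∷ xs) b Pb = foldl-preserves P pres xs _ (pres b x Pb)

<ᵇ-false⇒≥ : ∀ {m k} → (m <ᵇ k) ≡ false → k ≤ m
<ᵇ-false⇒≥ m≮k = ≮⇒≥ λ m<k → subst T m≮k (<⇒<ᵇ m<k)

∀-Bool? : {P : Bool → Set} → (∀ b → Dec (P b)) → Dec (∀ b → P b)
∀-Bool? P? with P? false | P? true
... | yes pf | yes pt = yes λ { false → pf ; true → pt }
... | no ¬pf | _      = no λ ∀P → ¬pf (∀P false)
... | _      | no ¬pt = no λ ∀P → ¬pt (∀P true)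

cancel-complement : ∀ {n p a a′ c} → p ≤ n →
                    p * a + (n ∸ p) * a′ ≤ n * a + c → (n ∸ p) * a′ ≤ (n ∸ p) * a + c
cancel-complement {n} {p} {a} {a′} {c} p≤n ≤n*a+c = +-cancelˡ-≤ (p * a) _ _ (begin
  p * a + (n ∸ p) * a′     ≤⟨ ≤n*a+c ⟩
  n * a + c                ≡⟨ cong (λ m → m * a + c) (sym (m+[n∸m]≡n p≤n)) ⟩
  (p + (n ∸ p)) * a + c    ≡⟨ cong (_+ c) (*-distribʳ-+ a p (n ∸ p)) ⟩
  p * a + (n ∸ p) * a + c  ≡⟨ +-assoc (p * a) _ c ⟩
  p * a + ((n ∸ p) * a + c) ∎)
  where open ≤-Reasoning

scale-increment : ∀ {m n a a′ c} → m * a′ ≤ m * a + c → n ≤ 2 * m → n * a′ ≤ n * a + 2 * c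
scale-increment {m} {n} {a} {a′} {c} ≤m*a+c n≤2m with a′ ≤? a
... | yes a′≤a = ≤-trans (*-monoʳ-≤ n a′≤a) (m≤m+n (n * a) (2 * c))
... | no  a′≰a = begin
  n * a′             ≡⟨ cong (n *_) a′≡a+d ⟩
  n * (a + d)        ≡⟨ *-distribˡ-+ n a d ⟩
  n * a + n * d      ≤⟨ +-monoʳ-≤ (n * a) n*d≤2c ⟩
  n * a + 2 * c      ∎
  where
  open ≤-Reasoning
  d : ℕ
  d = a′ ∸ a
  a′≡a+d : a′ ≡ a + d
  a′≡a+d = sym (m+[n∸m]≡n (<⇒≤ (≰⇒> a′≰a)))
  m*d≤c : m * d ≤ c
  m*d≤c = +-cancelˡ-≤ (m * a) _ _ (subst (_≤ m * a + c) (trans (cong (m *_) a′≡a+d) (*-distribˡ-+ m a d)) ≤m*a+c)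
  n*d≤2c : n * d ≤ 2 * c
  n*d≤2c = ≤-trans (*-monoˡ-≤ d n≤2m) (subst (_≤ 2 * c) (sym (*-assoc 2 m d)) (*-monoʳ-≤ 2 m*d≤c))

n≤2*[n∸p] : ∀ {n p} → 2 * p ≤ n → n ≤ 2 * (n ∸ p)
n≤2*[n∸p] {n} {p} 2p≤n = begin
  n                  ≡⟨ sym (m+[n∸m]≡n (m+n≤o⇒m≤o p p+p≤n)) ⟩
  p + (n ∸ p)        ≤⟨ +-monoˡ-≤ (n ∸ p) (m+n≤o⇒m≤o∸n p p+p≤n) ⟩
  (n ∸ p) + (n ∸ p)  ≡⟨ cong ((n ∸ p) +_) (sym (+-identityʳ (n ∸ p))) ⟩
  2 * (n ∸ p)        ∎
  where
  open ≤-Reasoning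
  p+p≤n : p + p ≤ n
  p+p≤n = subst (_≤ n) (cong (p +_) (+-identityʳ p)) 2p≤n

telescope : (f : ℕ → ℕ) {d : ℕ} → f 0 ≡ 0 → ∀ q → (∀ p → p < q → f (suc p) ≤ f p + d) → f q ≤ q * d
telescope f f0≡0 zero    _    = ≤-reflexive f0≡0
telescope f {d} f0≡0 (suc q) grow = begin
  f (suc q)  ≤⟨ grow q ≤-refl ⟩
  f q + d    ≤⟨ +-monoˡ-≤ d (telescope f f0≡0 q λ p p<q → grow p (m<n⇒m<1+n p<q)) ⟩
  q * d + d  ≡⟨ +-comm (q * d) d ⟩
  suc q * d  ∎
  where open ≤-Reasoning

injective⇒surjective : ∀ {n} {f : Fin n → Fin n} → (∀ {x y} → f x ≡ f y → x ≡ y) → ∀ y → ∃[ x ] f x ≡ y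
injective⇒surjective {suc m} {f} f-inj y with any? (λ x → f x ≟ y)
... | yes hit  = hit
... | no  miss = contradiction (injective⇒≤ g-inj) 1+n≰n
  where
  y≢f : ∀ x → y ≢ f x
  y≢f x y≡fx = miss (x , sym y≡fx)
  g : Fin (suc m) → Fin m
  g x = punchOut (y≢f x)
  g-inj : ∀ {x x′} → g x ≡ g x′ → x ≡ x′
  g-inj {x} {x′} gx≡gx′ = f-inj (punchOut-injective (y≢f x) (y≢f x′) gx≡gx′)

==-refl : (x : Fin n) → (x == x) ≡ true
==-refl x with x ≟ x
... | yes _   = refl
... | no x≢x = contradiction refl x≢x

isPerm⇒injective : (π : Vec (Fin n) n) → T (isPerm π) → ∀ {j k} → lookup π j ≡ lookup π k → j ≡ k
isPerm⇒injective π perm {j} {k} πj≡πk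
  with j ≟ k | All.lookup (all⁺ _ (allFin _) (All.lookup (all⁺ _ (allFin _) perm) (∈-allFin j))) (∈-allFin k)
... | yes j≡k | _        = j≡k
... | no  _   | distinct =
  ⊥-elim (subst (T ∘ not) (trans (cong (_== lookup π k) πj≡πk) (==-refl (lookup π k))) distinct)

injective⇒isPerm : ∀ {n} (π : Vec (Fin n) n) → (∀ {j k} → lookup π j ≡ lookup π k → j ≡ k) → T (isPerm π)
injective⇒isPerm {n} π π-inj =
  all⁻ _ {xs = allFin n} (All.tabulate λ _ → all⁻ _ {xs = allFin n} (All.tabulate λ _ → distinct _ _))
  where
  distinct : ∀ j k → T ((j == k) ∨ not (lookup π j == lookup π k))
  distinct j k with j ≟ k | lookup π j ≟ lookup π k
  ... | yes _   | _         = _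
  ... | no j≢k  | yes πj≡πk = j≢k (π-inj πj≡πk)
  ... | no _    | no _      = _

allVecs-suc : ∀ {n} k → allVecs {n} (suc k) ≡ cartesianProductWith _∷ᵥ_ (allFin n) (allVecs k)
allVecs-suc {n} k = go (allFin n)
  where
  go : ∀ xs → concatMap (λ x → map (x ∷ᵥ_) (allVecs {n} k)) xs ≡ cartesianProductWith _∷ᵥ_ xs (allVecs k)
  go []       = refl
  go (x ∷ xs) = cong (map (x ∷ᵥ_) (allVecs k) ++_) (go xs)

∈-allVecs : ∀ {n} k (v : Vec (Fin n) k) → v ∈ allVecs k
∈-allVecs zero    []ᵥ       = here refl
∈-allVecs {n} (suc k) (x ∷ᵥ v) rewrite allVecs-suc {n} k = ∈-cartesianProductWith⁺ _∷ᵥ_ (∈-allFin x) (∈-allVecs k v)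

allVecs-unique : ∀ {n} k → Unique (allVecs {n} k)
allVecs-unique zero    = All.[] AllPairs.∷ AllPairs.[]
allVecs-unique {n} (suc k) rewrite allVecs-suc {n} k =
  Unique.cartesianProductWith⁺ _∷ᵥ_ ∷ᵥ-injective (Unique.allFin⁺ n) (allVecs-unique k)

∈-perms⁺ : ∀ {n} (π : Vec (Fin n) n) → T (isPerm π) → π ∈ perms n
∈-perms⁺ {n} π = ∈-filter⁺ (T? ∘ isPerm) (∈-allVecs n π)

∈-perms⁻ : ∀ {n} {π : Vec (Fin n) n} → π ∈ perms n → T (isPerm π)
∈-perms⁻ {n} π∈ with _ , perm ← ∈-filter⁻ (T? ∘ isPerm) {xs = allVecs n} π∈ = perm

perms-unique : ∀ n → Unique (perms n)
perms-unique n = Unique.filter⁺ (T? ∘ isPerm) (allVecs-unique n)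

∑-lookup-perm : ∀ {n} {π : Vec (Fin n) n} → π ∈ perms n → (g : Fin n → ℕ) →
                ∑[ k ∈ allFin n ] g (lookup π k) ≡ ∑ (allFin n) g
∑-lookup-perm {n} {π} π∈ = ∑-reindex (Unique.allFin⁺ n) (Unique.allFin⁺ n) π-inj (λ _ → ∈-allFin _) onto
  where
  π-inj = isPerm⇒injective π (∈-perms⁻ π∈)
  onto : ∀ {u} → u ∈ allFin n → ∃[ k ] k ∈ allFin n × lookup π k ≡ u
  onto {u} _ with k , πk≡u ← injective⇒surjective π-inj u = k , ∈-allFin k , πk≡u

transpose-matchˡ : (i j : Fin n) → PC.transpose i j i ≡ j
transpose-matchˡ i j rewrite dec-true (i ≟ i) refl = refl

transpose-fix : (i j k : Fin n) → k ≢ i → k ≢ j → PC.transpose i j k ≡ k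
transpose-fix i j k k≢i k≢j rewrite dec-false (k ≟ i) k≢i | dec-false (k ≟ j) k≢j = refl

swap : Fin n → Fin n → Vec A n → Vec A n
swap i j v = tabulateᵥ (lookup v ∘ PC.transpose i j)

lookup-swap : (i j : Fin n) (v : Vec A n) (k : Fin n) → lookup (swap i j v) k ≡ lookup v (PC.transpose i j k)
lookup-swap i j v = lookup∘tabulate _

swap-inverse : (i j : Fin n) (v : Vec A n) → swap i j (swap j i v) ≡ v
swap-inverse i j v = trans (tabulateᵥ-cong λ k → trans (lookup-swap j i v _) (cong (lookup v) (PC.transpose-inverse j i)))
                           (tabulate∘lookup v)

swap-injective : (i j : Fin n) {v w : Vec A n} → swap i j v ≡ swap i j w → v ≡ w
swap-injective i j {v} {w} eq = trans (sym (swap-inverse j i v)) (trans (cong (swap j i) eq) (swap-inverse j i w))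

swap-isPerm : (i j : Fin n) {π : Vec (Fin n) n} → T (isPerm π) → T (isPerm (swap i j π))
swap-isPerm i j {π} perm = injective⇒isPerm (swap i j π) λ {a} {b} eq →
  trans (sym (PC.transpose-inverse j i)) (trans (cong (PC.transpose j i)
    (isPerm⇒injective π perm (trans (sym (lookup-swap i j π a)) (trans eq (lookup-swap i j π b)))))
    (PC.transpose-inverse j i))

∑-perms-swap : ∀ {n} (i j : Fin n) (G : Vec (Fin n) n → ℕ) → ∑[ π ∈ perms n ] G (swap i j π) ≡ ∑ (perms n) G
∑-perms-swap {n} i j = ∑-reindex (perms-unique n) (perms-unique n) (swap-injective i j)
  (λ {π} π∈ → ∈-perms⁺ (swap i j π) (swap-isPerm i j {π} (∈-perms⁻ π∈)))
  (λ {π} π∈ → swap j i π , ∈-perms⁺ (swap j i π) (swap-isPerm j i {π} (∈-perms⁻ π∈)) , swap-inverse i j π)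

lookup-∈-take : (v : Vec A n) (k : Fin n) {p : ℕ} → toℕ k < p → lookup v k ∈ take p (toList v)
lookup-∈-take (x ∷ᵥ v) fzero    {suc p} _         = here refl
lookup-∈-take (x ∷ᵥ v) (fsuc k) {suc p} (s≤s k<p) = there (lookup-∈-take v k k<p)

take-suc-toList : (v : Vec A n) (k : Fin n) → take (suc (toℕ k)) (toList v) ≡ take (toℕ k) (toList v) ++ [ lookup v k ]
take-suc-toList (x ∷ᵥ v) fzero    = refl
take-suc-toList (x ∷ᵥ v) (fsuc k) = cong (x ∷_) (take-suc-toList v k)

take-toList-cong : (v w : Vec A n) (p : ℕ) → (∀ k → toℕ k < p → lookup v k ≡ lookup w k) →
                   take p (toList v) ≡ take p (toList w)
take-toList-cong []ᵥ       []ᵥ       p       agree = refl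
take-toList-cong (x ∷ᵥ v) (y ∷ᵥ w) zero    agree = refl
take-toList-cong (x ∷ᵥ v) (y ∷ᵥ w) (suc p) agree =
  cong₂ _∷_ (agree fzero (s≤s z≤n)) (take-toList-cong v w p (λ k → agree (fsuc k) ∘ s≤s))
module _ {n : ℕ} (adj : Rel₂ n) where

  Skipped : State n → Fin n → Set
  Skipped s u = finished s ≡ true ⊎ alive s u ≡ false

  skipped⊎active : ∀ s u → Skipped s u ⊎ (finished s ≡ false × alive s u ≡ true)
  skipped⊎active s u with finished s | alive s u
  ... | true  | _     = inj₁ (inj₁ refl)
  ... | false | false = inj₁ (inj₂ refl)
  ... | false | true  = inj₂ (refl , refl)

  step-skipped : ∀ s u → Skipped s u → step adj s u ≡ s
  step-skipped s u (inj₁ done) rewrite done = refl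
  step-skipped s u (inj₂ dead) with finished s
  ... | true  = refl
  ... | false rewrite dead = refl

  step-skips-self : ∀ s u → Skipped (step adj s u) u
  step-skips-self s u with finished s in done
  ... | true = inj₁ done
  ... | false with alive s u in au
  ...   | false = inj₂ au
  ...   | true with undV s u
  ...     | true  rewrite ==-refl u | au = inj₂ refl
  ...     | false rewrite ==-refl u | au = inj₂ refl

  step-preserves-Skipped : ∀ s x u → Skipped s u → Skipped (step adj s x) u
  step-preserves-Skipped s x u (inj₁ done) rewrite done = inj₁ done
  step-preserves-Skipped s x u (inj₂ dead) with finished s
  ... | true = inj₂ dead
  ... | false with alive s x
  ...   | false = inj₂ dead
  ...   | true with undV s x
  ...     | true  rewrite dead = inj₂ refl
  ...     | false rewrite dead = inj₂ refl

  step-shrinks-undE : ∀ s x u w → undE (step adj s x) u w ≡ true → undE s u w ≡ true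
  step-shrinks-undE s x u w undE′ with finished s
  ... | true = undE′
  ... | false with alive s x
  ...   | false = undE′
  ...   | true with undV s x
  ...     | true  = ∧-conicalˡ _ _ undE′
  ...     | false = ∧-conicalˡ _ _ undE′

  decided : State n → Fin n → Bool
  decided s u = alive s u ∧ not (undV s u)

  boundary : State n → Fin n → Fin n → Bool
  boundary s u w = decided s u ∧ undV s w ∧ adj u w

  finished⇒undV-false : ∀ s w → finished s ≡ true → undV s w ≡ false
  finished⇒undV-false s w done = Equivalence.to T-not-≡ (proj₁ (Equivalence.to T-∧
    (All.lookup (all⁺ _ (allFin n) (Equivalence.from T-≡ done)) (∈-allFin w))))

  boundary-skipped : ∀ s u w → Skipped s u → boundary s u w ≡ false
  boundary-skipped s u w (inj₁ done) rewrite finished⇒undV-false s w done = ∧-zeroʳ (decided s u)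
  boundary-skipped s u w (inj₂ dead) rewrite dead = refl

  -- Steps (3) and (4) of F at a vertex w, with Uw = w ∈ V?, aw = w ∈ V, x = adj u w, e = (w == u)
  -- and r = (u,w) ∈ E?; both are checked on all 32 valuations.
  undecided-case3 : ∀ Uw aw x e r →
    ⟦ (Uw ∨ (aw ∧ x)) ∧ (aw ∧ not e) ⟧ + 0 ≤ ⟦ Uw ⟧ + ⟦ (aw ∧ not Uw) ∧ x ⟧ + ⟦ r ⟧
  undecided-case3 =
    toWitness {a? = ∀-Bool? λ _ → ∀-Bool? λ _ → ∀-Bool? λ _ → ∀-Bool? λ _ → ∀-Bool? λ _ → _ ≤? _} _

  undecided-case4 : ∀ Uw aw x e r →
    ⟦ (Uw ∨ ((aw ∧ x) ∧ r)) ∧ (aw ∧ (not e ∧ not ((aw ∧ x) ∧ not r))) ⟧ + ⟦ Uw ∧ x ⟧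
      ≤ ⟦ Uw ⟧ + ⟦ (aw ∧ not Uw) ∧ false ⟧ + ⟦ r ⟧
  undecided-case4 =
    toWitness {a? = ∀-Bool? λ _ → ∀-Bool? λ _ → ∀-Bool? λ _ → ∀-Bool? λ _ → ∀-Bool? λ _ → _ ≤? _} _

  undecided-step-pointwise : (∀ u v → adj u v ≡ adj v u) → ∀ s u w →
    ⟦ undV (step adj s u) w ⟧ + ⟦ boundary s u w ⟧ ≤ ⟦ undV s w ⟧ + ⟦ boundary s w u ⟧ + ⟦ undE s u w ⟧
  undecided-step-pointwise adj-sym s u w with skipped⊎active s u
  ... | inj₁ sk rewrite step-skipped s u sk | boundary-skipped s u w sk | +-identityʳ ⟦ undV s w ⟧ =
    ≤-trans (m≤m+n _ _) (m≤m+n _ _)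
  ... | inj₂ (live , au) rewrite live | au with undV s u
  ...   | true rewrite adj-sym w u = undecided-case3 (undV s w) (alive s w) (adj u w) (w == u) (undE s u w)
  ...   | false = undecided-case4 (undV s w) (alive s w) (adj u w) (w == u) (undE s u w)

module _ {n : ℕ} where

  ∑∑ : (Fin n → Fin n → ℕ) → ℕ
  ∑∑ f = ∑[ u ∈ allFin n ] ∑[ w ∈ allFin n ] f u w

  ∑∑-mono : {f g : Fin n → Fin n → ℕ} → (∀ u w → f u w ≤ g u w) → ∑∑ f ≤ ∑∑ g
  ∑∑-mono f≤g = ∑-mono (allFin n) λ {u} _ → ∑-mono (allFin n) λ {w} _ → f≤g u w

  ∑∑-distrib-+ : (f g : Fin n → Fin n → ℕ) → ∑∑ (λ u w → f u w + g u w) ≡ ∑∑ f + ∑∑ g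
  ∑∑-distrib-+ f g = trans (∑-cong (allFin n) λ u → ∑-distrib-+ (allFin n) (f u) (g u)) (∑-distrib-+ (allFin n) _ _)

  ∑∑-transpose : (f : Fin n → Fin n → ℕ) → ∑∑ (λ u w → f w u) ≡ ∑∑ f
  ∑∑-transpose f = ∑-comm (allFin n) (allFin n) (λ u w → f w u)

  card≡∑ : (X : Fin n → Bool) → card X ≡ ∑[ w ∈ allFin n ] ⟦ X w ⟧
  card≡∑ X = length-filterᵇ X (allFin n)

  handshake : (r : Rel₂ n) → (∀ u v → r u v ≡ r v u) → (∀ u → r u u ≡ false) →
              ∑∑ (λ u v → ⟦ r u v ⟧) ≤ 2 * edgeCount r
  handshake r r-sym r-irrefl = begin
    ∑∑ (λ u v → ⟦ r u v ⟧)                         ≤⟨ ∑∑-mono split ⟩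
    ∑∑ (λ u v → ⟦ forward u v ⟧ + ⟦ forward v u ⟧) ≡⟨ ∑∑-distrib-+ _ _ ⟩
    E + ∑∑ (λ u v → ⟦ forward v u ⟧)               ≡⟨ cong (E +_) (∑∑-transpose _) ⟩
    E + E                                          ≡⟨ cong (E +_) (sym (+-identityʳ E)) ⟩
    2 * E                                          ≡⟨ cong (2 *_) (sym edgeCount≡E) ⟩
    2 * edgeCount r                                ∎
    where
    open ≤-Reasoning
    forward : Fin n → Fin n → Bool
    forward u v = (toℕ u <ᵇ toℕ v) ∧ r u v
    E : ℕ
    E = ∑∑ (λ u v → ⟦ forward u v ⟧)
    edgeCount≡E : edgeCount r ≡ E
    edgeCount≡E = ∑-cong (allFin n) λ u → length-filterᵇ (forward u) (allFin n)
    split : ∀ u v → ⟦ r u v ⟧ ≤ ⟦ forward u v ⟧ + ⟦ forward v u ⟧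
    split u v with toℕ u <ᵇ toℕ v in u≮v | toℕ v <ᵇ toℕ u in v≮u
    ... | true  | _    = m≤m+n _ _
    ... | false | true rewrite r-sym v u = m≤n+m _ _
    ... | false | false with toℕ-injective {i = u} {j = v} (≤-antisym (<ᵇ-false⇒≥ v≮u) (<ᵇ-false⇒≥ u≮v))
    ...   | refl rewrite r-irrefl u = z≤n

module _ {n : ℕ} (adj eu : Rel₂ n)
  (adj-sym : ∀ u v → adj u v ≡ adj v u)
  (eu-sym : ∀ u v → eu u v ≡ eu v u)
  (eu-irrefl : ∀ u → eu u u ≡ false) where

  ∑-card-step : ∀ s → (∀ u w → undE s u w ≡ true → eu u w ≡ true) →
    ∑[ u ∈ allFin n ] card (undV (step adj s u)) ≤ n * card (undV s) + 2 * edgeCount eu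
  ∑-card-step s undE⊆eu = +-cancelʳ-≤ (∑∑ pair) _ _ (begin
    ∑[ u ∈ allFin n ] card (undV (step adj s u)) + ∑∑ pair
      ≡⟨ cong (_+ ∑∑ pair) (∑-cong (allFin n) λ u → card≡∑ (undV (step adj s u))) ⟩
    ∑∑ after + ∑∑ pair
      ≡⟨ sym (∑∑-distrib-+ after pair) ⟩
    ∑∑ (λ u w → after u w + pair u w)
      ≤⟨ ∑∑-mono (undecided-step-pointwise adj adj-sym s) ⟩
    ∑∑ (λ u w → before u w + pair w u + edge u w)
      ≡⟨ trans (∑∑-distrib-+ _ edge) (cong (_+ ∑∑ edge) (∑∑-distrib-+ before λ u w → pair w u)) ⟩
    ∑∑ before + ∑∑ (λ u w → pair w u) + ∑∑ edge
      ≡⟨ cong₂ (λ a b → a + b + ∑∑ edge) ∑∑-before (∑∑-transpose pair) ⟩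
    n * card (undV s) + ∑∑ pair + ∑∑ edge
      ≤⟨ +-monoʳ-≤ (n * card (undV s) + ∑∑ pair) (≤-trans (∑∑-mono edge≤eu) (handshake eu eu-sym eu-irrefl)) ⟩
    n * card (undV s) + ∑∑ pair + 2 * edgeCount eu
      ≡⟨ xy∙z≈xz∙y (n * card (undV s)) (∑∑ pair) _ ⟩
    n * card (undV s) + 2 * edgeCount eu + ∑∑ pair ∎)
    where
    open ≤-Reasoning
    after before pair edge : Fin n → Fin n → ℕ
    after  u w = ⟦ undV (step adj s u) w ⟧
    before u w = ⟦ undV s w ⟧
    pair   u w = ⟦ boundary adj s u w ⟧
    edge   u w = ⟦ undE s u w ⟧
    ∑∑-before : ∑∑ before ≡ n * card (undV s)
    ∑∑-before = trans (∑-const (allFin n) _) (cong₂ _*_ (length-tabulate {n = n} (λ k → k)) (sym (card≡∑ (undV s))))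
    edge≤eu : ∀ u w → edge u w ≤ ⟦ eu u w ⟧
    edge≤eu u w with undE s u w in e
    ... | false = z≤n
    ... | true rewrite undE⊆eu u w e = ≤-refl

module _ {n : ℕ} (adj eu : Rel₂ n) where

  run : Vec (Fin n) n → ℕ → State n
  run π p = foldl (step adj) (initState eu) (take p (toList π))

  -- undecidedTotal p is n! · E|V?_{p+1}|, since undecidedAt π i is the state after i ∸ 1 calls.
  undecidedTotal : ℕ → ℕ
  undecidedTotal p = ∑[ π ∈ perms n ] card (undV (run π p))

  undecidedTotal-zero : undecidedTotal 0 ≡ 0
  undecidedTotal-zero =
    trans (∑-cong (perms n) λ _ → trans (card≡∑ {n = n} λ _ → false) (∑-zero (allFin n))) (∑-zero (perms n))

  run-⊆-eu : ∀ π p u w → undE (run π p) u w ≡ true → eu u w ≡ true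
  run-⊆-eu π p = foldl-preserves (λ s → ∀ u w → undE s u w ≡ true → eu u w ≡ true)
    (λ s x ⊆eu u w e → ⊆eu u w (step-shrinks-undE adj s x u w e)) (take p (toList π)) (initState eu) (λ _ _ e → e)

  foldl-step-skips : ∀ {u} xs s → u ∈ xs → Skipped adj (foldl (step adj) s xs) u
  foldl-step-skips {u} (x ∷ xs) s (here refl) =
    foldl-preserves (λ s′ → Skipped adj s′ u) (λ s′ y → step-preserves-Skipped adj s′ y u) xs _
                    (step-skips-self adj s x)
  foldl-step-skips (x ∷ xs) s (there u∈xs) = foldl-step-skips xs (step adj s x) u∈xs

  run-skips-prefix : ∀ π (k : Fin n) {p} → toℕ k < p → Skipped adj (run π p) (lookup π k)
  run-skips-prefix π k k<p = foldl-step-skips _ (initState eu) (lookup-∈-take π k k<p)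

  run-suc : ∀ π (p : Fin n) → step adj (run π (toℕ p)) (lookup π p) ≡ run π (suc (toℕ p))
  run-suc π p = sym (trans (cong (foldl (step adj) (initState eu)) (take-suc-toList π p))
                           (foldl-++ (step adj) (initState eu) (take (toℕ p) (toList π)) [ lookup π p ]))

  run-swap : ∀ π (p k : Fin n) → toℕ p ≤ toℕ k → run (swap p k π) (toℕ p) ≡ run π (toℕ p)
  run-swap π p k p≤k = cong (foldl (step adj) (initState eu)) (take-toList-cong (swap p k π) π (toℕ p) λ j j<p →
    trans (lookup-swap p k π j) (cong (lookup π) (transpose-fix p k j
      (λ j≡p → <-irrefl (cong toℕ j≡p) j<p)
      (λ j≡k → <-irrefl refl (<-≤-trans j<p (subst (λ i → toℕ p ≤ toℕ i) (sym j≡k) p≤k))))))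

module _ {n : ℕ} (adj eu : Rel₂ n)
  (adj-sym : ∀ u v → adj u v ≡ adj v u)
  (eu-sym : ∀ u v → eu u v ≡ eu v u)
  (eu-irrefl : ∀ u → eu u u ≡ false) where

  private
    total : ℕ → ℕ
    total = undecidedTotal adj eu

    afterCall : ℕ → Vec (Fin n) n → Fin n → ℕ
    afterCall p π k = card (undV (step adj (run adj eu π p) (lookup π k)))

  ∑-afterCall-≡ : (p : Fin n) → ∑[ π ∈ perms n ] ∑[ k ∈ allFin n ] afterCall (toℕ p) π k
                            ≡ toℕ p * total (toℕ p) + (n ∸ toℕ p) * total (suc (toℕ p))
  ∑-afterCall-≡ p = trans (∑-comm (perms n) (allFin n) (afterCall (toℕ p)))
    (∑-allFin-split n (toℕ p) (λ k → ∑[ π ∈ perms n ] afterCall (toℕ p) π k) (<⇒≤ (toℕ<n p))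
                    processed unprocessed)
    where
    processed : ∀ k → toℕ k < toℕ p → ∑[ π ∈ perms n ] afterCall (toℕ p) π k ≡ total (toℕ p)
    processed k k<p = ∑-cong (perms n) λ π →
      cong (card ∘ undV) (step-skipped adj _ _ (run-skips-prefix adj eu π k k<p))
    -- Swapping positions p and k of π keeps the first p calls and permutes perms n.
    unprocessed : ∀ k → toℕ p ≤ toℕ k → ∑[ π ∈ perms n ] afterCall (toℕ p) π k ≡ total (suc (toℕ p))
    unprocessed k p≤k = trans (∑-cong (perms n) λ π → cong (card ∘ undV) (sym (swapped π)))
                              (∑-perms-swap p k λ π → card (undV (run adj eu π (suc (toℕ p)))))
      where
      swapped : ∀ π → run adj eu (swap p k π) (suc (toℕ p)) ≡ step adj (run adj eu π (toℕ p)) (lookup π k)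
      swapped π = begin
        run adj eu (swap p k π) (suc (toℕ p))                         ≡⟨ sym (run-suc adj eu (swap p k π) p) ⟩
        step adj (run adj eu (swap p k π) (toℕ p)) (lookup (swap p k π) p)
          ≡⟨ cong₂ (step adj) (run-swap adj eu π p k p≤k)
                   (trans (lookup-swap p k π p) (cong (lookup π) (transpose-matchˡ p k))) ⟩
        step adj (run adj eu π (toℕ p)) (lookup π k)                   ∎
        where open ≡-Reasoning

  ∑-afterCall-≤ : (p : ℕ) → ∑[ π ∈ perms n ] ∑[ k ∈ allFin n ] afterCall p π k
                        ≤ n * total p + length (perms n) * (2 * edgeCount eu)
  ∑-afterCall-≤ p = begin
    ∑[ π ∈ perms n ] ∑[ k ∈ allFin n ] afterCall p π k
      ≤⟨ ∑-mono (perms n) (λ {π} π∈ → ≤-reflexive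
           (∑-lookup-perm π∈ λ u → card (undV (step adj (run adj eu π p) u)))) ⟩
    ∑[ π ∈ perms n ] ∑[ u ∈ allFin n ] card (undV (step adj (run adj eu π p) u))
      ≤⟨ ∑-mono (perms n) (λ {π} _ → ∑-card-step adj eu adj-sym eu-sym eu-irrefl (run adj eu π p)
                                                  (run-⊆-eu adj eu π p)) ⟩
    ∑[ π ∈ perms n ] (n * card (undV (run adj eu π p)) + 2 * edgeCount eu)
      ≡⟨ ∑-distrib-+ (perms n) _ _ ⟩
    ∑[ π ∈ perms n ] (n * card (undV (run adj eu π p))) + ∑[ _ ∈ perms n ] (2 * edgeCount eu)
      ≡⟨ cong₂ _+_ (∑-distribˡ-* (perms n) n _) (∑-const (perms n) _) ⟩
    n * total p + length (perms n) * (2 * edgeCount eu) ∎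
    where open ≤-Reasoning

  undecidedTotal-suc : ∀ p → 2 * p < n →
    n * total (suc p) ≤ n * total p + 2 * (length (perms n) * (2 * edgeCount eu))
  undecidedTotal-suc p 2p<n with fromℕ< p<n | toℕ-fromℕ< p<n
    where p<n : p < n
          p<n = ≤-<-trans (m≤m+n p (p + 0)) 2p<n
  ... | p′ | refl = scale-increment {m = n ∸ toℕ p′} (cancel-complement (<⇒≤ (toℕ<n p′)) averaged)
                                    (n≤2*[n∸p] {p = toℕ p′} (<⇒≤ 2p<n))
    where
    averaged : toℕ p′ * total (toℕ p′) + (n ∸ toℕ p′) * total (suc (toℕ p′))
                 ≤ n * total (toℕ p′) + length (perms n) * (2 * edgeCount eu)
    averaged = ≤-trans (≤-reflexive (sym (∑-afterCall-≡ p′))) (∑-afterCall-≤ (toℕ p′))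

mainTheorem8 : (n : ℕ) (adj eu : Rel₂ n)
    → (∀ u v → adj u v ≡ adj v u)
    → (∀ u → adj u u ≡ false)
    → (∀ u v → eu u v ≡ eu v u)
    → (∀ u v → eu u v ≡ true → adj u v ≡ true)
    → (i : ℕ) → 1 ≤ i → 4 * i < n
    → n * sum (map (λ π → card (undecidedAt adj eu π i)) (perms n))
      ≤ 4 * edgeCount eu * i * length (perms n)
mainTheorem8 n adj eu adj-sym adj-irrefl eu-sym eu⊆adj i _ 4i<n = begin
  n * undecidedTotal adj eu (i ∸ 1)
    ≤⟨ telescope (λ p → n * undecidedTotal adj eu p) (trans (cong (n *_) (undecidedTotal-zero adj eu)) (*-zeroʳ n)) (i ∸ 1)
                 (λ p p<i∸1 → undecidedTotal-suc adj eu adj-sym eu-sym eu-irrefl p (2p<n p<i∸1)) ⟩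
  (i ∸ 1) * δ                              ≤⟨ *-monoˡ-≤ δ (m∸n≤m i 1) ⟩
  i * δ                                    ≡⟨ rearrange i (length (perms n)) (edgeCount eu) ⟩
  4 * edgeCount eu * i * length (perms n)  ∎
  where
  open ≤-Reasoning
  δ : ℕ
  δ = 2 * (length (perms n) * (2 * edgeCount eu))
  rearrange : ∀ i N b → i * (2 * (N * (2 * b))) ≡ 4 * b * i * N
  rearrange = solve-∀
  eu-irrefl : ∀ u → eu u u ≡ false
  eu-irrefl u with eu u u in e
  ... | false = refl
  ... | true  = contradiction (trans (sym (eu⊆adj u u e)) (adj-irrefl u)) λ ()
  2p<n : ∀ {p} → p < i ∸ 1 → 2 * p < n
  2p<n p<i∸1 = ≤-<-trans (*-mono-≤ {y = 4} (s≤s (s≤s z≤n)) (≤-trans (<⇒≤ p<i∸1) (m∸n≤m i 1))) 4i<n
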